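{- Let $m,i$ be natural numbers with $0<m\leq i$ (natural numbers are identified with the terms $s^k(0)$). Let $cs,us,ds$ be terms. Then: (a) for all ground terms $t,t'$: if the triple $(cs,[t|us],ds)$ is correct up to $m$ w.r.t. $i$, then the triple $(cs,us,[t'|ds])$ is correct up to $m$ w.r.t. $i+1$; (b) for every ground term $t'$: if $(cs,us,[t'|ds])$ is correct up to $m$ w.r.t. $i+1$, then there exists a ground term $t$ such that $(cs,[t|us],ds)$ is correct up to $m$ w.r.t. $i$.
   Context: Terms are first-order terms over a fixed alphabet of function symbols (including the constant $0$, the unary symbol $s$, and the Prolog list constructors $[\,]$ and $[\cdot|\cdot]$); ground terms are variable-free terms. Prolog list notation is used: $[e_1,\ldots,e_n|e]$ stands for $e$ when $n=0$. A list of length $n$ is a term $[e_1,\ldots,e_n]$. A term $e$ is the $k$-th member ($k>0$) of a term $t$ if $t=[e_1,\ldots,e_{k-1},e|e']$ for some terms $e_1,\ldots,e_{k-1},e'$; $e$ is a member of $t$ if it is the $k$-th member for some $k>0$. A list of distinct members is a list whose members are pairwise distinct terms. Diagonal numbers: if a number $j$ is the $k$-th member of a list $cs$, then the up diagonal number of $j$ w.r.t. $i$ in $cs$ is $k+j-i$, and the down diagonal number of $j$ w.r.t. $i$ in $cs$ is $k+i-j$. Correct triple: a triple of terms $(cs,us,ds)$ is correct up to $m$ w.r.t. $i$ when $0\leq m\leq i$ and: $cs$ is a list of distinct members and each $j\in\{1,\ldots,m\}$ is a member of $cs$; the up diagonal numbers of $1,\ldots,m$ in $cs$ are pairwise distinct,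 and the down diagonal numbers of $1,\ldots,m$ in $cs$ are pairwise distinct; and for each $j\in\{1,\ldots,m\}$, if the up (respectively down) diagonal number of $j$ w.r.t. $i$ in $cs$ is $l>0$, then the $l$-th member of $us$ (respectively $ds$) is $j$. -}

module Defs where

open import Data.Nat using (ℕ; zero; suc; _≤_; _<_)
open import Data.Integer as ℤ using (ℤ; +_)
open import Data.List using (List)
open import Data.List.Relation.Unary.All using (All)
open import Data.Product using (Σ; ∃; _×_; _,_)
open import Data.Empty using (⊥)
open import Relation.Binary.PropositionalEquality using (_≡_; _≢_)

data Term : Set where
  var  : ℕ → Term
  zro  : Term
  s    : Term → Term
  nil  : Term
  cons : Term → Term → Term
  fn   : ℕ → List Term → Term

data Ground : Term → Set where
  zroG  : Ground zro
  sG    : ∀ {t} → Ground t → Ground (s t)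
  nilG  : Ground nil
  consG : ∀ {t u} → Ground t → Ground u → Ground (cons t u)
  fnG   : ∀ {f ts} → All Ground ts → Ground (fn f ts)

num : ℕ → Term
num zero    = zro
num (suc k) = s (num k)

Kth : ℕ → Term → Term → Set
Kth zero          e t = ⊥
Kth (suc zero)    e t = ∃ λ e' → t ≡ cons e e'
Kth (suc (suc k)) e t = ∃ λ e₁ → ∃ λ r → t ≡ cons e₁ r × Kth (suc k) e r

data IsList : Term → Set where
  nilL  : IsList nil
  consL : ∀ {e t} → IsList t → IsList (cons e t)

DistinctList : Term → Set
DistinctList t = IsList t × (∀ k k' e → Kth k e t → Kth k' e t → k ≡ k')

upDiag : ℕ → ℕ → ℕ → ℤ
upDiag k j i = (+ k ℤ.+ + j) ℤ.- + i

downDiag : ℕ → ℕ → ℕ → ℤ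
downDiag k j i = (+ k ℤ.+ + i) ℤ.- + j

InRange : ℕ → ℕ → Set
InRange m j = 1 ≤ j × j ≤ m

Correct : ℕ → ℕ → Term → Term → Term → Set
Correct m i cs us ds =
  m ≤ i
  × DistinctList cs
  × (∀ j → InRange m j → ∃ λ k → Kth k (num j) cs)
  × (∀ j₁ j₂ k₁ k₂ → InRange m j₁ → InRange m j₂ → j₁ ≢ j₂ →
       Kth k₁ (num j₁) cs → Kth k₂ (num j₂) cs →
       upDiag k₁ j₁ i ≢ upDiag k₂ j₂ i)
  × (∀ j₁ j₂ k₁ k₂ → InRange m j₁ → InRange m j₂ → j₁ ≢ j₂ →
       Kth k₁ (num j₁) cs → Kth k₂ (num j₂) cs →
       downDiag k₁ j₁ i ≢ downDiag k₂ j₂ i)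
  × (∀ j k l → InRange m j → Kth k (num j) cs → 0 < l →
       upDiag k j i ≡ + l → Kth l (num j) us)
  × (∀ j k l → InRange m j → Kth k (num j) cs → 0 < l →
       downDiag k j i ≡ + l → Kth l (num j) ds)

module Submission where

-- Moving from row i to row i+1 lowers every up diagonal number
-- by one and raises every down diagonal number by one.  Hence pairwise
-- distinctness of the diagonal numbers is unaffected, and the lists that
-- record which value sits on which diagonal are shifted by one position:
-- us loses its head (the occupant of up diagonal 1 at row i) and ds gains
-- a new head (down diagonal 1 at row i+1, which no j ≤ m ≤ i can occupy).

open import Defs
open import Data.Nat as ℕ using (ℕ; zero; suc; _≤_; _<_; z≤n; s≤s; _≤?_; _≟_)
import Data.Nat.Properties as ℕₚ
open import Data.Integer as ℤ using (ℤ; +_; _-_; 1ℤ; pred) renaming (suc to sucℤ)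
import Data.Integer.Properties as ℤₚ
open import Data.Integer.Tactic.RingSolver using (solve-∀)
open import Data.Product using (∃; _×_; _,_; proj₁; proj₂)
open import Data.Empty using (⊥-elim)
open import Function using (_∘_)
open import Relation.Nullary using (Dec; yes; no)
open import Relation.Nullary.Decidable using (_×-dec_)
open import Relation.Binary.PropositionalEquality
  using (_≡_; _≢_; refl; sym; trans; cong; subst)

Diagonal : Set
Diagonal = ℕ → ℕ → ℕ → ℤ

Members : ℕ → Term → Set
Members m cs = ∀ j → InRange m j → ∃ λ k → Kth k (num j) cs

DiagonalsDistinct : Diagonal → ℕ → ℕ → Term → Set
DiagonalsDistinct d m i cs =
  ∀ j₁ j₂ k₁ k₂ → InRange m j₁ → InRange m j₂ → j₁ ≢ j₂ →
  Kth k₁ (num j₁) cs → Kth k₂ (num j₂) cs → d k₁ j₁ i ≢ d k₂ j₂ i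

Recorded : Diagonal → ℕ → ℕ → Term → Term → Set
Recorded d m i cs xs =
  ∀ j k l → InRange m j → Kth k (num j) cs → 0 < l →
  d k j i ≡ + l → Kth l (num j) xs

-- Diagonal d₁ at row i₁ numbers every position one higher than d₂ at row i₂.
-- (A record, so that the diagonals involved stay visible to type inference.)
record OneAbove (d₁ : Diagonal) (i₁ : ℕ) (d₂ : Diagonal) (i₂ : ℕ) : Set where
  constructor oneAbove
  field shift : ∀ k j → d₁ k j i₁ ≡ sucℤ (d₂ k j i₂)

kth-pos : ∀ {k e t} → Kth k e t → 0 < k
kth-pos {suc k} _ = s≤s z≤n

kth-tail : ∀ {l e t xs} → 0 < l → Kth (suc l) e (cons t xs) → Kth l e xs
kth-tail {suc l} _ (_ , _ , refl , p) = p

kth-cons : ∀ {l e} t {xs} → 0 < l → Kth l e xs → Kth (suc l) e (cons t xs)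
kth-cons {suc l} t {xs} _ p = t , xs , refl , p

num-ground : ∀ j → Ground (num j)
num-ground zero    = zroG
num-ground (suc j) = sG (num-ground j)

sucℤ-injective : ∀ {a b} → sucℤ a ≡ sucℤ b → a ≡ b
sucℤ-injective {a} {b} eq =
  trans (sym (ℤₚ.pred-suc a)) (trans (cong pred eq) (ℤₚ.pred-suc b))

up-step : ∀ i → OneAbove upDiag i upDiag (suc i)
up-step i = oneAbove λ k j → shift (+ k ℤ.+ + j) (+ i)
  where
  shift : ∀ x y → x - y ≡ 1ℤ ℤ.+ (x - (1ℤ ℤ.+ y))
  shift = solve-∀

down-step : ∀ i → OneAbove downDiag (suc i) downDiag i
down-step i = oneAbove λ k j → shift (+ k) (+ i) (+ j)
  where
  shift : ∀ x y z → (x ℤ.+ (1ℤ ℤ.+ y)) - z ≡ 1ℤ ℤ.+ ((x ℤ.+ y) - z)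
  shift = solve-∀

downDiag-nonzero : ∀ {k j i} → 0 < k → j ≤ i → downDiag k j i ≢ + 0
downDiag-nonzero {k} {j} {i} 0<k j≤i eq =
  ℕₚ.<-irrefl (sym k+i≡j) (ℕₚ.≤-trans (s≤s j≤i) (ℕₚ.+-monoˡ-≤ i 0<k))
  where
  k+i≡j : k ℕ.+ i ≡ j
  k+i≡j = ℤₚ.+-injective (ℤₚ.i-j≡0⇒i≡j (+ (k ℕ.+ i)) (+ j) eq)

distinct-down : ∀ {d₁ i₁ d₂ i₂ m cs} → OneAbove d₁ i₁ d₂ i₂ →
  DiagonalsDistinct d₁ m i₁ cs → DiagonalsDistinct d₂ m i₂ cs
distinct-down (oneAbove shift) dist j₁ j₂ k₁ k₂ r₁ r₂ ne p₁ p₂ eq =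
  dist j₁ j₂ k₁ k₂ r₁ r₂ ne p₁ p₂
    (trans (shift k₁ j₁) (trans (cong sucℤ eq) (sym (shift k₂ j₂))))

distinct-up : ∀ {d₁ i₁ d₂ i₂ m cs} → OneAbove d₁ i₁ d₂ i₂ →
  DiagonalsDistinct d₂ m i₂ cs → DiagonalsDistinct d₁ m i₁ cs
distinct-up (oneAbove shift) dist j₁ j₂ k₁ k₂ r₁ r₂ ne p₁ p₂ eq =
  dist j₁ j₂ k₁ k₂ r₁ r₂ ne p₁ p₂
    (sucℤ-injective (trans (sym (shift k₁ j₁)) (trans eq (shift k₂ j₂))))

recorded-tail : ∀ {d₁ i₁ d₂ i₂ m cs t xs} → OneAbove d₁ i₁ d₂ i₂ →
  Recorded d₁ m i₁ cs (cons t xs) → Recorded d₂ m i₂ cs xs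
recorded-tail (oneAbove shift) rec j k l r p 0<l eq =
  kth-tail 0<l (rec j k (suc l) r p (s≤s z≤n) (trans (shift k j) (cong sucℤ eq)))

recorded-cons : ∀ {d₁ i₁ d₂ i₂ m cs t xs} → OneAbove d₁ i₁ d₂ i₂ →
  (∀ j k → InRange m j → Kth k (num j) cs → d₂ k j i₂ ≡ + 0 → t ≡ num j) →
  Recorded d₂ m i₂ cs xs → Recorded d₁ m i₁ cs (cons t xs)
recorded-cons {xs = xs} (oneAbove shift) head rec j k (suc zero) r p _ eq =
  xs , cong (λ u → cons u xs) (head j k r p (sucℤ-injective (trans (sym (shift k j)) eq)))
recorded-cons {t = t} (oneAbove shift) head rec j k (suc (suc l)) r p _ eq =
  kth-cons t (s≤s z≤n)
    (rec j k (suc l) r p (s≤s z≤n) (sucℤ-injective (trans (sym (shift k j)) eq)))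

-- When cs has distinct members, whether e sits at a position satisfying a
-- decidable property Q is decided by inspecting its (unique) position.
position-dec : ∀ {e cs} {Q : ℕ → Set} → DistinctList cs →
  (∀ k → Dec (Q k)) → ∃ (λ k → Kth k e cs) → Dec (∃ λ k → Kth k e cs × Q k)
position-dec {e} {Q = Q} (_ , unique) Q? (k₀ , p₀) with Q? k₀
... | yes q = yes (k₀ , p₀ , q)
... | no ¬q = no λ (k , p , q) → ¬q (subst Q (unique k k₀ e p p₀) q)

-- On each diagonal c lies at most one value j ∈ {1,…,m}; some ground term
-- names it (found by bounded search), or any ground term if there is none.
occupant : ∀ {d m i cs} → DistinctList cs → Members m cs →
  DiagonalsDistinct d m i cs → (c : ℤ) →
  ∃ λ t → Ground t × (∀ j k → InRange m j → Kth k (num j) cs → d k j i ≡ c → t ≡ num j)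
occupant {d} {m} {i} {cs} dl mem dist c with ℕₚ.anyUpTo? onDiagonal? (suc m)
  where
  OnDiagonal : ℕ → Set
  OnDiagonal j = InRange m j × ∃ λ k → Kth k (num j) cs × d k j i ≡ c

  onDiagonal? : ∀ j → Dec (OnDiagonal j)
  onDiagonal? j with 1 ≤? j ×-dec j ≤? m
  ... | no ¬r = no (¬r ∘ proj₁)
  ... | yes r with position-dec dl (λ k → d k j i ℤ.≟ c) (mem j r)
  ...   | yes on  = yes (r , on)
  ...   | no ¬on = no (¬on ∘ proj₂)
... | yes (j₀ , _ , r₀ , k₀ , p₀ , e₀) = num j₀ , num-ground j₀ , same
  where
  same : ∀ j k → InRange m j → Kth k (num j) cs → d k j i ≡ c → num j₀ ≡ num j
  same j k r p e with j ≟ j₀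
  ... | yes refl = refl
  ... | no j≢j₀  = ⊥-elim (dist j j₀ k k₀ r r₀ j≢j₀ p p₀ (trans e (sym e₀)))
... | no none = zro , zroG ,
  λ j k r p e → ⊥-elim (none (j , s≤s (proj₂ r) , r , k , p , e))

lemma7 : (m i : ℕ) → 0 < m → m ≤ i → (cs us ds : Term) →
    (∀ t t' → Ground t → Ground t' →
    Correct m i cs (cons t us) ds → Correct m (suc i) cs us (cons t' ds))
    × (∀ t' → Ground t' → Correct m (suc i) cs us (cons t' ds) →
    ∃ λ t → Ground t × Correct m i cs (cons t us) ds)
lemma7 m i _ m≤i cs us ds = forward , backward
  where
  -- (a): us loses its head; ds gains one, as down diagonal 0 is empty.
  forward : ∀ t t' → Ground t → Ground t' →
    Correct m i cs (cons t us) ds → Correct m (suc i) cs us (cons t' ds)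
  forward t t' _ _ (_ , dl , mem , up≠ , down≠ , upRec , downRec) =
    ℕₚ.m≤n⇒m≤1+n m≤i , dl , mem ,
    distinct-down (up-step i) up≠ , distinct-up (down-step i) down≠ ,
    recorded-tail (up-step i) upRec ,
    recorded-cons (down-step i) noneOnZero downRec
    where
    noneOnZero : ∀ j k → InRange m j → Kth k (num j) cs → downDiag k j i ≡ + 0 → t' ≡ num j
    noneOnZero j k r p e =
      ⊥-elim (downDiag-nonzero (kth-pos p) (ℕₚ.≤-trans (proj₂ r) m≤i) e)

  -- (b): ds loses its head; us gains the occupant of up diagonal 0 at row i+1.
  backward : ∀ t' → Ground t' → Correct m (suc i) cs us (cons t' ds) →
    ∃ λ t → Ground t × Correct m i cs (cons t us) ds
  backward t' _ (_ , dl , mem , up≠ , down≠ , upRec , downRec)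
    with occupant {d = upDiag} {i = suc i} dl mem up≠ (+ 0)
  ... | t , ground , onZero =
    t , ground , m≤i , dl , mem ,
    distinct-up (up-step i) up≠ , distinct-down (down-step i) down≠ ,
    recorded-cons (up-step i) onZero upRec ,
    recorded-tail (down-step i) downRec
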